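{- The direct sum of two Euclidean oriented matroids is Euclidean.
   Context: An oriented matroid program $(\mathcal{O},g,f)$ ($g$ not a loop, $f$ not a coloop) is Euclidean in the sense of Edmonds–Mandel (Björner et al., "Oriented Matroids", Sect. 10.5); an oriented matroid is Euclidean if all its oriented matroid programs are Euclidean. The direct sum $\mathcal{O}^1\oplus\mathcal{O}^2$ of oriented matroids on disjoint ground sets is the oriented matroid whose covectors are the concatenations of a covector of $\mathcal{O}^1$ with a covector of $\mathcal{O}^2$. -}

module Defs where

open import Data.Nat using (ℕ; suc; _+_)
open import Data.Fin using (Fin; zero; suc)
open import Data.Vec using (Vec; lookup; map; zipWith; replicate; _∷_; tail; _++_)
open import Data.Product using (Σ; ∃; ∃-syntax; _×_; _,_)
open import Data.Sum using (_⊎_)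
open import Relation.Binary.PropositionalEquality using (_≡_; _≢_)
open import Relation.Nullary using (¬_)

data Sign : Set where
  minus zer plus : Sign

neg : Sign → Sign
neg minus = plus
neg zer   = zer
neg plus  = minus

SignVec : ℕ → Set
SignVec n = Vec Sign n

0v : ∀ {n} → SignVec n
0v = replicate _ zer

-_ᵥ : ∀ {n} → SignVec n → SignVec n
- X ᵥ = map neg X

compS : Sign → Sign → Sign
compS zer y = y
compS x   _ = x

_∘ᵥ_ : ∀ {n} → SignVec n → SignVec n → SignVec n
X ∘ᵥ Y = zipWith compS X Y

Sep : ∀ {n} → SignVec n → SignVec n → Fin n → Set
Sep X Y e = (lookup X e ≢ zer) × (lookup X e ≡ neg (lookup Y e))

-- Oriented matroids on ground set Fin n, given by their set of covectors

Covectors : ℕ → Set₁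
Covectors n = SignVec n → Set

-- Covector axioms (L0)-(L3), Björner et al., Def. 4.1.1
record IsOM {n} (L : Covectors n) : Set where
  field
    zero∈   : L 0v
    neg∈    : ∀ X → L X → L (- X ᵥ)
    comp∈   : ∀ X Y → L X → L Y → L (X ∘ᵥ Y)
    elim    : ∀ X Y → L X → L Y → ∀ e → Sep X Y e →
              ∃[ Z ] (L Z × lookup Z e ≡ zer ×
                      (∀ f → ¬ Sep X Y f → lookup Z f ≡ lookup (X ∘ᵥ Y) f))

_≼_ : ∀ {n} → SignVec n → SignVec n → Set
Z ≼ X = ∀ e → (lookup Z e ≡ zer) ⊎ (lookup Z e ≡ lookup X e)

IsCocircuit : ∀ {n} → Covectors n → SignVec n → Set
IsCocircuit L Y =
  L Y × (Y ≢ 0v) × (∀ Z → L Z → Z ≼ Y → (Z ≡ 0v) ⊎ (Z ≡ Y))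

IsLoop : ∀ {n} → Covectors n → Fin n → Set
IsLoop L e = ∀ X → L X → lookup X e ≡ zer

IsColoop : ∀ {n} → Covectors n → Fin n → Set
IsColoop L e = ∃[ X ] (L X × lookup X e ≢ zer × (∀ f → f ≢ e → lookup X f ≡ zer))

-- Single element extensions: the new element p is position zero of
-- Fin (suc n); the old element e is (suc e).  L̃ extends L iff the
-- deletion L̃ \ p equals L.

IsExtension : ∀ {n} → Covectors n → Covectors (suc n) → Set
IsExtension L L̃ = ∀ X → (L X → ∃[ X̃ ] (L̃ X̃ × tail X̃ ≡ X))
                       × (∃[ X̃ ] (L̃ X̃ × tail X̃ ≡ X) → L X)

-- Euclidean programs (Edmonds–Mandel; Björner et al. Sect. 10.5):
-- for every cocircuit Y with Y_g = + there is a single element extension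
-- by p such that p is "parallel" to f (p and f agree on every covector
-- vanishing on g, i.e. p ∥ f in the contraction by g) and (Y,0) is a
-- cocircuit of the extension (the hyperplane through Y parallel to f).

IsEuclideanProgram : ∀ {n} → Covectors n → Fin n → Fin n → Set₁
IsEuclideanProgram {n} L g f =
  ∀ Y → IsCocircuit L Y → lookup Y g ≡ plus →
  Σ (Covectors (suc n)) λ L̃ →
      IsOM L̃ × IsExtension L L̃
    × (∀ X̃ → L̃ X̃ → lookup X̃ (suc g) ≡ zer → lookup X̃ zero ≡ lookup X̃ (suc f))
    × IsCocircuit L̃ (zer ∷ Y)

IsEuclidean : ∀ {n} → Covectors n → Set₁
IsEuclidean L = ∀ g f → ¬ IsLoop L g → ¬ IsColoop L f → IsEuclideanProgram L g f

_⊕_ : ∀ {m n} → Covectors m → Covectors n → Covectors (m + n)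
(L₁ ⊕ L₂) X = ∃[ X₁ ] ∃[ X₂ ] (L₁ X₁ × L₂ X₂ × X ≡ X₁ ++ X₂)

-- Let g, f be elements of the ground set of A ⊕ B, g not a loop, and Y a cocircuit with
-- Y(g) = +.  Cocircuits of a direct sum are cocircuits of one summand padded with zeros,
-- so Y lives on the summand containing g.  If f lies in the same summand, the Euclidean
-- extension of that summand, summed with the other one, is the required extension.  If f
-- lies in the other summand, then Y(f) = 0 and the extension by an element parallel to f
-- (a copy of f) already has (0,Y) as a cocircuit.
module Submission where

open import Defs
open import Level using (Level)
open import Data.Nat using (ℕ; suc)
open import Data.Fin using (Fin; zero; suc)
open import Data.Fin.Properties using (+↔⊎)
open import Data.Vec using (_∷_; lookup; tabulate; tail; _++_)
open import Data.Vec.Properties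
  using (lookup∘tabulate; lookup-map; lookup-zipWith; lookup-replicate; lookup-++ˡ; lookup-++ʳ)
open import Data.Vec.Relation.Binary.Pointwise.Extensional using (ext; Pointwise-≡⇒≡)
open import Data.Product as Product using (Σ; ∃-syntax; _×_; _,_; proj₁; proj₂)
open import Data.Sum as Sum using (_⊎_; inj₁; inj₂; [_,_]; [_,_]′)
open import Data.Sum.Algebra using (⊎-comm)
open import Function using (_∘_; id; _↔_; Inverse; mk↔ₛ′)
open import Function.Properties.Inverse using (↔-trans)
open import Relation.Binary.PropositionalEquality
open import Relation.Nullary using (¬_; contradiction)

private
  variable
    k n : ℕ

plus≢zer : plus ≢ zer
plus≢zer ()

-- Z ≼ X and Sep X Y e unfold coordinatewise to these relations on signs, so subst₂
-- transports them along equations between entries.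
_≼ₛ_ : Sign → Sign → Set
z ≼ₛ x = (z ≡ zer) ⊎ (z ≡ x)

SepSign : Sign → Sign → Set
SepSign x y = (x ≢ zer) × (x ≡ neg y)

≼-refl : {X : SignVec n} → X ≼ X
≼-refl _ = inj₂ refl

lookup-ext : {X Y : SignVec n} → (∀ e → lookup X e ≡ lookup Y e) → X ≡ Y
lookup-ext = Pointwise-≡⇒≡ ∘ ext

lookup-0v : (e : Fin n) → lookup 0v e ≡ zer
lookup-0v e = lookup-replicate e zer

≼0v⇒≡0v : {Z : SignVec n} → Z ≼ 0v → Z ≡ 0v
≼0v⇒≡0v Z≼0 = lookup-ext λ e → [ (λ z → trans z (sym (lookup-0v e))) , id ]′ (Z≼0 e)

Elimination : Covectors n → SignVec n → SignVec n → Fin n → Set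
Elimination L X Y e =
  ∃[ Z ] (L Z × lookup Z e ≡ zer × (∀ f → ¬ Sep X Y f → lookup Z f ≡ lookup (X ∘ᵥ Y) f))

ParallelInContraction : Covectors (suc n) → Fin n → Fin n → Set
ParallelInContraction L̃ g f =
  ∀ X̃ → L̃ X̃ → lookup X̃ (suc g) ≡ zer → lookup X̃ zero ≡ lookup X̃ (suc f)

EuclideanExtension : Covectors n → Fin n → Fin n → SignVec n → Set₁
EuclideanExtension {n} L g f Y =
  Σ (Covectors (suc n)) λ L̃ →
    IsOM L̃ × IsExtension L L̃ × ParallelInContraction L̃ g f × IsCocircuit L̃ (zer ∷ Y)

restrict : ∀ {a} → (Fin a → Fin k) → SignVec k → SignVec a
restrict ι X = tabulate (lookup X ∘ ι)

module _ {a} (ι : Fin a → Fin k) where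

  lookup-restrict : ∀ X i → lookup (restrict ι X) i ≡ lookup X (ι i)
  lookup-restrict X = lookup∘tabulate (lookup X ∘ ι)

  restrict-≡⇒lookup-≡ : ∀ {X Y} → restrict ι X ≡ restrict ι Y →
    ∀ i → lookup X (ι i) ≡ lookup Y (ι i)
  restrict-≡⇒lookup-≡ {X} {Y} eq i = begin
    lookup X (ι i)             ≡⟨ lookup-restrict X i ⟨
    lookup (restrict ι X) i    ≡⟨ cong (λ V → lookup V i) eq ⟩
    lookup (restrict ι Y) i    ≡⟨ lookup-restrict Y i ⟩
    lookup Y (ι i)             ∎
    where open ≡-Reasoning

  restrict-0v : restrict ι 0v ≡ 0v
  restrict-0v = lookup-ext λ i → trans (lookup-restrict 0v i) (trans (lookup-0v (ι i)) (sym (lookup-0v i)))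

  restrict-neg : ∀ X → restrict ι (- X ᵥ) ≡ - restrict ι X ᵥ
  restrict-neg X = lookup-ext λ i → begin
    lookup (restrict ι (- X ᵥ)) i    ≡⟨ lookup-restrict (- X ᵥ) i ⟩
    lookup (- X ᵥ) (ι i)             ≡⟨ lookup-map (ι i) neg X ⟩
    neg (lookup X (ι i))             ≡⟨ cong neg (lookup-restrict X i) ⟨
    neg (lookup (restrict ι X) i)    ≡⟨ lookup-map i neg (restrict ι X) ⟨
    lookup (- restrict ι X ᵥ) i      ∎
    where open ≡-Reasoning

  lookup-restrict-∘ᵥ : ∀ X Y i → lookup (restrict ι X ∘ᵥ restrict ι Y) i ≡ lookup (X ∘ᵥ Y) (ι i)
  lookup-restrict-∘ᵥ X Y i = begin
    lookup (restrict ι X ∘ᵥ restrict ι Y) i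
      ≡⟨ lookup-zipWith compS i (restrict ι X) (restrict ι Y) ⟩
    compS (lookup (restrict ι X) i) (lookup (restrict ι Y) i)
      ≡⟨ cong₂ compS (lookup-restrict X i) (lookup-restrict Y i) ⟩
    compS (lookup X (ι i)) (lookup Y (ι i))
      ≡⟨ lookup-zipWith compS (ι i) X Y ⟨
    lookup (X ∘ᵥ Y) (ι i)
      ∎
    where open ≡-Reasoning

  restrict-∘ᵥ : ∀ X Y → restrict ι (X ∘ᵥ Y) ≡ restrict ι X ∘ᵥ restrict ι Y
  restrict-∘ᵥ X Y = lookup-ext λ i → trans (lookup-restrict (X ∘ᵥ Y) i) (sym (lookup-restrict-∘ᵥ X Y i))

  restrict-≼ : ∀ {Z X} → Z ≼ X → restrict ι Z ≼ restrict ι X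
  restrict-≼ {Z} {X} Z≼X i =
    subst₂ _≼ₛ_ (sym (lookup-restrict Z i)) (sym (lookup-restrict X i)) (Z≼X (ι i))

  Sep-restrict⁻ : ∀ X Y i → Sep (restrict ι X) (restrict ι Y) i → Sep X Y (ι i)
  Sep-restrict⁻ X Y i = subst₂ SepSign (lookup-restrict X i) (lookup-restrict Y i)

  Sep-restrict⁺ : ∀ X Y i → Sep X Y (ι i) → Sep (restrict ι X) (restrict ι Y) i
  Sep-restrict⁺ X Y i = subst₂ SepSign (sym (lookup-restrict X i)) (sym (lookup-restrict Y i))

-- Direct sums are taken along an arbitrary decomposition σ of the ground set into two
-- blocks, so that the sum with the blocks exchanged and the sum with a new element in
-- front are again such sums, along swap σ and extend σ.
module _ {k a b} (σ : Fin k ↔ (Fin a ⊎ Fin b)) where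
  open Inverse σ using (to; from; strictlyInverseˡ; strictlyInverseʳ)

  ι₁ : Fin a → Fin k
  ι₁ = from ∘ inj₁

  ι₂ : Fin b → Fin k
  ι₂ = from ∘ inj₂

  by-blocks : ∀ {p : Level} (P : Fin k → Set p) →
    (∀ i → P (ι₁ i)) → (∀ j → P (ι₂ j)) → ∀ e → P e
  by-blocks P P₁ P₂ e = subst P (strictlyInverseʳ e) ([_,_] {C = P ∘ from} P₁ P₂ (to e))

  restrict-injective : ∀ {X Y : SignVec k} →
    restrict ι₁ X ≡ restrict ι₁ Y → restrict ι₂ X ≡ restrict ι₂ Y → X ≡ Y
  restrict-injective {X} {Y} eq₁ eq₂ =
    lookup-ext (by-blocks _ (restrict-≡⇒lookup-≡ ι₁ {X} {Y} eq₁)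
                            (restrict-≡⇒lookup-≡ ι₂ {X} {Y} eq₂))

  glue : SignVec a → SignVec b → SignVec k
  glue U V = tabulate ([ lookup U , lookup V ]′ ∘ to)

  lookup-glue₁ : ∀ U V i → lookup (glue U V) (ι₁ i) ≡ lookup U i
  lookup-glue₁ U V i =
    trans (lookup∘tabulate _ (ι₁ i)) (cong [ lookup U , lookup V ]′ (strictlyInverseˡ (inj₁ i)))

  lookup-glue₂ : ∀ U V j → lookup (glue U V) (ι₂ j) ≡ lookup V j
  lookup-glue₂ U V j =
    trans (lookup∘tabulate _ (ι₂ j)) (cong [ lookup U , lookup V ]′ (strictlyInverseˡ (inj₂ j)))

  restrict-glue₁ : ∀ U V → restrict ι₁ (glue U V) ≡ U
  restrict-glue₁ U V = lookup-ext λ i → trans (lookup-restrict ι₁ (glue U V) i) (lookup-glue₁ U V i)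

  restrict-glue₂ : ∀ U V → restrict ι₂ (glue U V) ≡ V
  restrict-glue₂ U V = lookup-ext λ j → trans (lookup-restrict ι₂ (glue U V) j) (lookup-glue₂ U V j)

  ≡-glue : ∀ {X U V} → restrict ι₁ X ≡ U → restrict ι₂ X ≡ V → X ≡ glue U V
  ≡-glue {X} {U} {V} eq₁ eq₂ =
    restrict-injective (trans eq₁ (sym (restrict-glue₁ U V))) (trans eq₂ (sym (restrict-glue₂ U V)))

  glue-injective₁ : ∀ {U U′ V V′} → glue U V ≡ glue U′ V′ → U ≡ U′
  glue-injective₁ {U} {U′} {V} {V′} eq =
    trans (sym (restrict-glue₁ U V)) (trans (cong (restrict ι₁) eq) (restrict-glue₁ U′ V′))

  glue-0v : glue 0v 0v ≡ 0v
  glue-0v = sym (≡-glue (restrict-0v ι₁) (restrict-0v ι₂))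

  glue-≼ : ∀ {U U′ V V′} → U′ ≼ U → V′ ≼ V → glue U′ V′ ≼ glue U V
  glue-≼ {U} {U′} {V} {V′} U′≼U V′≼V = by-blocks _
    (λ i → subst₂ _≼ₛ_ (sym (lookup-glue₁ U′ V′ i)) (sym (lookup-glue₁ U V i)) (U′≼U i))
    (λ j → subst₂ _≼ₛ_ (sym (lookup-glue₂ U′ V′ j)) (sym (lookup-glue₂ U V j)) (V′≼V j))

_⊕⟨_⟩_ : ∀ {a b} → Covectors a → Fin k ↔ (Fin a ⊎ Fin b) → Covectors b → Covectors k
(A ⊕⟨ σ ⟩ B) X = A (restrict (ι₁ σ) X) × B (restrict (ι₂ σ) X)

swap : ∀ {a b} → Fin k ↔ (Fin a ⊎ Fin b) → Fin k ↔ (Fin b ⊎ Fin a)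
swap σ = ↔-trans σ (⊎-comm _ _)

extend : ∀ {a b} → Fin k ↔ (Fin a ⊎ Fin b) → Fin (suc k) ↔ (Fin (suc a) ⊎ Fin b)
extend {k} {a} {b} σ = mk↔ₛ′ to⁺ from⁺ to⁺∘from⁺ from⁺∘to⁺
  where
    open Inverse σ using (to; from; strictlyInverseˡ; strictlyInverseʳ)

    to⁺ : Fin (suc k) → Fin (suc a) ⊎ Fin b
    to⁺ zero    = inj₁ zero
    to⁺ (suc e) = Sum.map₁ suc (to e)

    from⁺ : Fin (suc a) ⊎ Fin b → Fin (suc k)
    from⁺ (inj₁ zero)    = zero
    from⁺ (inj₁ (suc i)) = suc (from (inj₁ i))
    from⁺ (inj₂ j)       = suc (from (inj₂ j))

    from⁺-map₁-suc : ∀ s → from⁺ (Sum.map₁ suc s) ≡ suc (from s)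
    from⁺-map₁-suc (inj₁ i) = refl
    from⁺-map₁-suc (inj₂ j) = refl

    to⁺∘from⁺ : ∀ s → to⁺ (from⁺ s) ≡ s
    to⁺∘from⁺ (inj₁ zero)    = refl
    to⁺∘from⁺ (inj₁ (suc i)) = cong (Sum.map₁ suc) (strictlyInverseˡ (inj₁ i))
    to⁺∘from⁺ (inj₂ j)       = cong (Sum.map₁ suc) (strictlyInverseˡ (inj₂ j))

    from⁺∘to⁺ : ∀ e → from⁺ (to⁺ e) ≡ e
    from⁺∘to⁺ zero    = refl
    from⁺∘to⁺ (suc e) = trans (from⁺-map₁-suc (to e)) (cong suc (strictlyInverseʳ e))

glue-extend : ∀ {a b} (σ : Fin k ↔ (Fin a ⊎ Fin b)) x U V →
  glue (extend σ) (x ∷ U) V ≡ x ∷ glue σ U V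
glue-extend σ x U V =
  sym (≡-glue (extend σ) (cong (x ∷_) (restrict-glue₁ σ U V)) (restrict-glue₂ σ U V))

module _ {n} {L L′ : Covectors n} (L⊆L′ : ∀ X → L X → L′ X) (L′⊆L : ∀ X → L′ X → L X) where

  isLoop-resp : ∀ {e} → IsLoop L′ e → IsLoop L e
  isLoop-resp loop X x = loop X (L⊆L′ X x)

  isColoop-resp : ∀ {e} → IsColoop L′ e → IsColoop L e
  isColoop-resp (X , x , rest) = X , L′⊆L X x , rest

  isEuclideanProgram-resp : ∀ {g f} → IsEuclideanProgram L′ g f → IsEuclideanProgram L g f
  isEuclideanProgram-resp euclid Y (y , Y≢0 , minimal) Yg
    with euclid Y (L⊆L′ Y y , Y≢0 , λ Z z → minimal Z (L′⊆L Z z)) Yg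
  ... | L̃ , isOM , extension , parallel , cocircuit =
    L̃ , isOM , (λ X → proj₁ (extension X) ∘ L⊆L′ X , L′⊆L X ∘ proj₂ (extension X)) ,
    parallel , cocircuit

  isEuclidean-resp : IsEuclidean L′ → IsEuclidean L
  isEuclidean-resp euclid g f ¬loop ¬coloop =
    isEuclideanProgram-resp (euclid g f (¬loop ∘ isLoop-resp) (¬coloop ∘ isColoop-resp))

module _ {a b} (σ : Fin k ↔ (Fin a ⊎ Fin b)) {A : Covectors a} {B : Covectors b} where

  glue-∈ : ∀ U V → A U → B V → (A ⊕⟨ σ ⟩ B) (glue σ U V)
  glue-∈ U V u v = subst A (sym (restrict-glue₁ σ U V)) u , subst B (sym (restrict-glue₂ σ U V)) v

  elimination-ι₁ : IsOM A → IsOM B → ∀ X Y → (A ⊕⟨ σ ⟩ B) X → (A ⊕⟨ σ ⟩ B) Y →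
    ∀ i → Sep X Y (ι₁ σ i) → Elimination (A ⊕⟨ σ ⟩ B) X Y (ι₁ σ i)
  elimination-ι₁ isOMᴬ isOMᴮ X Y (x₁ , x₂) (y₁ , y₂) i sep
    with IsOM.elim isOMᴬ _ _ x₁ y₁ i (Sep-restrict⁺ (ι₁ σ) X Y i sep)
  ... | Z₁ , z₁ , Z₁i≡0 , Z₁-agrees =
    glue σ Z₁ XY₂ , glue-∈ Z₁ XY₂ z₁ xy₂ , trans (lookup-glue₁ σ Z₁ XY₂ i) Z₁i≡0 ,
    by-blocks σ _ agrees₁ agrees₂
    where
      XY₂ = restrict (ι₂ σ) (X ∘ᵥ Y)

      xy₂ : B XY₂
      xy₂ = subst B (sym (restrict-∘ᵥ (ι₂ σ) X Y)) (IsOM.comp∈ isOMᴮ _ _ x₂ y₂)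

      agrees₁ : ∀ i′ → ¬ Sep X Y (ι₁ σ i′) →
        lookup (glue σ Z₁ XY₂) (ι₁ σ i′) ≡ lookup (X ∘ᵥ Y) (ι₁ σ i′)
      agrees₁ i′ ¬sep = trans (lookup-glue₁ σ Z₁ XY₂ i′)
        (trans (Z₁-agrees i′ (¬sep ∘ Sep-restrict⁻ (ι₁ σ) X Y i′)) (lookup-restrict-∘ᵥ (ι₁ σ) X Y i′))

      agrees₂ : ∀ j → ¬ Sep X Y (ι₂ σ j) →
        lookup (glue σ Z₁ XY₂) (ι₂ σ j) ≡ lookup (X ∘ᵥ Y) (ι₂ σ j)
      agrees₂ j _ = trans (lookup-glue₂ σ Z₁ XY₂ j) (lookup-restrict (ι₂ σ) (X ∘ᵥ Y) j)

  isLoop-ι₁ : ∀ {g} → IsLoop A g → IsLoop (A ⊕⟨ σ ⟩ B) (ι₁ σ g)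
  isLoop-ι₁ {g} loop X (x₁ , _) = trans (sym (lookup-restrict (ι₁ σ) X g)) (loop _ x₁)

  isColoop-ι₁ : IsOM B → ∀ {f} → IsColoop A f → IsColoop (A ⊕⟨ σ ⟩ B) (ι₁ σ f)
  isColoop-ι₁ isOMᴮ {f} (X , x , Xf≢0 , rest) =
    glue σ X 0v , glue-∈ X 0v x (IsOM.zero∈ isOMᴮ) , Xf≢0 ∘ trans (sym (lookup-glue₁ σ X 0v f)) ,
    by-blocks σ _ (λ i i≢f → trans (lookup-glue₁ σ X 0v i) (rest i (i≢f ∘ cong (ι₁ σ))))
                  (λ j _ → trans (lookup-glue₂ σ X 0v j) (lookup-0v j))

  glue-≡0v⇒≡0v : ∀ {U} → glue σ U 0v ≡ 0v → U ≡ 0v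
  glue-≡0v⇒≡0v {U} eq = glue-injective₁ σ {U} {0v} {0v} {0v} (trans eq (sym (glue-0v σ)))

  cocircuit-glue⁺ : IsOM B → ∀ {U} → IsCocircuit A U → IsCocircuit (A ⊕⟨ σ ⟩ B) (glue σ U 0v)
  cocircuit-glue⁺ isOMᴮ {U} (u , U≢0 , minimal) =
    glue-∈ U 0v u (IsOM.zero∈ isOMᴮ) , U≢0 ∘ glue-≡0v⇒≡0v , minimal⊕
    where
      minimal⊕ : ∀ Z → (A ⊕⟨ σ ⟩ B) Z → Z ≼ glue σ U 0v → (Z ≡ 0v) ⊎ (Z ≡ glue σ U 0v)
      minimal⊕ Z (z₁ , _) Z≼ =
        Sum.map (λ Z₁≡0 → trans (≡-glue σ {Z} Z₁≡0 Z₂≡0) (glue-0v σ))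
                (λ Z₁≡U → ≡-glue σ {Z} Z₁≡U Z₂≡0)
                (minimal _ z₁ Z₁≼U)
        where
          Z₁≼U : restrict (ι₁ σ) Z ≼ U
          Z₁≼U = subst (restrict (ι₁ σ) Z ≼_) (restrict-glue₁ σ U 0v)
                       (restrict-≼ (ι₁ σ) {Z} {glue σ U 0v} Z≼)

          Z₂≡0 : restrict (ι₂ σ) Z ≡ 0v
          Z₂≡0 = ≼0v⇒≡0v (subst (restrict (ι₂ σ) Z ≼_) (restrict-glue₂ σ U 0v)
                                (restrict-≼ (ι₂ σ) {Z} {glue σ U 0v} Z≼))

  cocircuit-glue⁻ : IsOM B → ∀ {U} → IsCocircuit (A ⊕⟨ σ ⟩ B) (glue σ U 0v) → IsCocircuit A U
  cocircuit-glue⁻ isOMᴮ {U} ((u , _) , glue≢0 , minimal) =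
    subst A (restrict-glue₁ σ U 0v) u ,
    (λ U≡0 → glue≢0 (trans (cong (λ V → glue σ V 0v) U≡0) (glue-0v σ))) ,
    minimalᴬ
    where
      minimalᴬ : ∀ Z → A Z → Z ≼ U → (Z ≡ 0v) ⊎ (Z ≡ U)
      minimalᴬ Z z Z≼U = Sum.map glue-≡0v⇒≡0v (glue-injective₁ σ {Z} {U} {0v} {0v})
        (minimal (glue σ Z 0v) (glue-∈ Z 0v z (IsOM.zero∈ isOMᴮ))
                 (glue-≼ σ {U} {Z} {0v} {0v} Z≼U (≼-refl {X = 0v})))

  cocircuit-support₁ : IsOM B → ∀ {Y g} → IsCocircuit (A ⊕⟨ σ ⟩ B) Y → lookup Y (ι₁ σ g) ≢ zer →
    Y ≡ glue σ (restrict (ι₁ σ) Y) 0v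
  cocircuit-support₁ isOMᴮ {Y} {g} ((y₁ , _) , _ , minimal) Yg≢0 =
    [ (λ glue≡0 → contradiction (Yg≡0 glue≡0) Yg≢0) , sym ]′
      (minimal (glue σ Y₁ 0v) (glue-∈ Y₁ 0v y₁ (IsOM.zero∈ isOMᴮ)) glue≼Y)
    where
      Y₁ = restrict (ι₁ σ) Y

      glue≼Y : glue σ Y₁ 0v ≼ Y
      glue≼Y = by-blocks σ _ (λ i → inj₂ (trans (lookup-glue₁ σ Y₁ 0v i) (lookup-restrict (ι₁ σ) Y i)))
                             (λ j → inj₁ (trans (lookup-glue₂ σ Y₁ 0v j) (lookup-0v j)))

      Yg≡0 : glue σ Y₁ 0v ≡ 0v → lookup Y (ι₁ σ g) ≡ zer
      Yg≡0 glue≡0 = trans (restrict-≡⇒lookup-≡ (ι₁ σ) {Y} {0v} Y₁≡0 g) (lookup-0v (ι₁ σ g))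
        where Y₁≡0 = trans (glue-≡0v⇒≡0v glue≡0) (sym (restrict-0v (ι₁ σ)))

isOM-⊕⟨⟩ : ∀ {a b} (σ : Fin k ↔ (Fin a ⊎ Fin b)) {A B} → IsOM A → IsOM B → IsOM (A ⊕⟨ σ ⟩ B)
isOM-⊕⟨⟩ σ {A} {B} isOMᴬ isOMᴮ = record
  { zero∈ = subst A (sym (restrict-0v (ι₁ σ))) (IsOM.zero∈ isOMᴬ)
          , subst B (sym (restrict-0v (ι₂ σ))) (IsOM.zero∈ isOMᴮ)
  ; neg∈  = λ X (x₁ , x₂) →
      subst A (sym (restrict-neg (ι₁ σ) X)) (IsOM.neg∈ isOMᴬ _ x₁) ,
      subst B (sym (restrict-neg (ι₂ σ) X)) (IsOM.neg∈ isOMᴮ _ x₂)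
  ; comp∈ = λ X Y (x₁ , x₂) (y₁ , y₂) →
      subst A (sym (restrict-∘ᵥ (ι₁ σ) X Y)) (IsOM.comp∈ isOMᴬ _ _ x₁ y₁) ,
      subst B (sym (restrict-∘ᵥ (ι₂ σ) X Y)) (IsOM.comp∈ isOMᴮ _ _ x₂ y₂)
  ; elim  = λ X Y x y → by-blocks σ _
      (elimination-ι₁ σ isOMᴬ isOMᴮ X Y x y)
      (λ j → Product.map₂ (Product.map₁ Product.swap)
               ∘ elimination-ι₁ (swap σ) {B} {A} isOMᴮ isOMᴬ X Y (Product.swap x) (Product.swap y) j)
  }

dup : Fin n → SignVec n → SignVec (suc n)
dup f X = lookup X f ∷ X

copy : Covectors n → Fin n → Covectors (suc n)
copy L f X̃ = ∃[ X ] (L X × X̃ ≡ dup f X)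

module _ {n} {L : Covectors n} (f : Fin n) where

  fromCopy : Fin (suc n) → Fin n
  fromCopy zero    = f
  fromCopy (suc e) = e

  lookup-dup : ∀ X e → lookup (dup f X) e ≡ lookup X (fromCopy e)
  lookup-dup X zero    = refl
  lookup-dup X (suc e) = refl

  lookup-dup-∘ᵥ : ∀ X Y e → lookup (dup f X ∘ᵥ dup f Y) e ≡ lookup (X ∘ᵥ Y) (fromCopy e)
  lookup-dup-∘ᵥ X Y e = begin
    lookup (dup f X ∘ᵥ dup f Y) e                          ≡⟨ lookup-zipWith compS e (dup f X) (dup f Y) ⟩
    compS (lookup (dup f X) e) (lookup (dup f Y) e)        ≡⟨ cong₂ compS (lookup-dup X e) (lookup-dup Y e) ⟩
    compS (lookup X (fromCopy e)) (lookup Y (fromCopy e))  ≡⟨ lookup-zipWith compS (fromCopy e) X Y ⟨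
    lookup (X ∘ᵥ Y) (fromCopy e)                           ∎
    where open ≡-Reasoning

  0v≡dup-0v : 0v ≡ dup f 0v
  0v≡dup-0v = cong (_∷ 0v) (sym (lookup-0v f))

  isOM-copy : IsOM L → IsOM (copy L f)
  isOM-copy isOM = record
    { zero∈ = 0v , IsOM.zero∈ isOM , 0v≡dup-0v
    ; neg∈  = λ { _ (X , x , refl) →
        - X ᵥ , IsOM.neg∈ isOM X x , cong (_∷ - X ᵥ) (sym (lookup-map f neg X)) }
    ; comp∈ = λ { _ _ (X , x , refl) (Y , y , refl) →
        X ∘ᵥ Y , IsOM.comp∈ isOM X Y x y , cong (_∷ X ∘ᵥ Y) (sym (lookup-zipWith compS f X Y)) }
    ; elim  = elimination
    }
    where
      elimination : ∀ X̃ Ỹ → copy L f X̃ → copy L f Ỹ →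
        ∀ e → Sep X̃ Ỹ e → Elimination (copy L f) X̃ Ỹ e
      elimination _ _ (X , x , refl) (Y , y , refl) e sep
        with IsOM.elim isOM X Y x y (fromCopy e) (subst₂ SepSign (lookup-dup X e) (lookup-dup Y e) sep)
      ... | Z , z , Z≡0 , Z-agrees =
        dup f Z , (Z , z , refl) , trans (lookup-dup Z e) Z≡0 ,
        λ e′ ¬sep → trans (lookup-dup Z e′)
          (trans (Z-agrees _ (¬sep ∘ subst₂ SepSign (sym (lookup-dup X e′)) (sym (lookup-dup Y e′))))
                 (sym (lookup-dup-∘ᵥ X Y e′)))

  isExtension-copy : IsExtension L (copy L f)
  isExtension-copy X = (λ x → dup f X , (X , x , refl) , refl) , λ { (_ , (_ , x , refl) , refl) → x }

  parallel-copy : ∀ g → ParallelInContraction (copy L f) g f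
  parallel-copy g _ (_ , _ , refl) _ = refl

  cocircuit-copy : ∀ {Y} → IsCocircuit L Y → lookup Y f ≡ zer → IsCocircuit (copy L f) (zer ∷ Y)
  cocircuit-copy {Y} (y , Y≢0 , minimal) Yf≡0 =
    (Y , y , cong (_∷ Y) (sym Yf≡0)) , Y≢0 ∘ cong tail , minimalᶜ
    where
      minimalᶜ : ∀ Z̃ → copy L f Z̃ → Z̃ ≼ (zer ∷ Y) → (Z̃ ≡ 0v) ⊎ (Z̃ ≡ zer ∷ Y)
      minimalᶜ _ (Z , z , refl) Z̃≼ with minimal Z z (Z̃≼ ∘ suc)
      ... | inj₁ refl = inj₁ (sym 0v≡dup-0v)
      ... | inj₂ refl = inj₂ (cong (_∷ Y) Yf≡0)

  copy-extension : IsOM L → ∀ {g Y} → IsCocircuit L Y → lookup Y f ≡ zer → EuclideanExtension L g f Y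
  copy-extension isOM {g} cocircuit Yf≡0 =
    copy L f , isOM-copy isOM , isExtension-copy , parallel-copy g , cocircuit-copy cocircuit Yf≡0

module _ {a b} (σ : Fin k ↔ (Fin a ⊎ Fin b)) {A : Covectors a} {B : Covectors b} where

  isExtension-extend : ∀ {Ã} → IsExtension A Ã → IsExtension (A ⊕⟨ σ ⟩ B) (Ã ⊕⟨ extend σ ⟩ B)
  isExtension-extend {Ã} extension X = lift , lower
    where
      lift : (A ⊕⟨ σ ⟩ B) X → ∃[ X̃ ] ((Ã ⊕⟨ extend σ ⟩ B) X̃ × tail X̃ ≡ X)
      lift (x₁ , x₂) with proj₁ (extension _) x₁
      ... | (x ∷ _) , x̃₁ , refl = (x ∷ X) , (x̃₁ , x₂) , refl

      lower : ∃[ X̃ ] ((Ã ⊕⟨ extend σ ⟩ B) X̃ × tail X̃ ≡ X) → (A ⊕⟨ σ ⟩ B) X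
      lower ((x ∷ _) , (x̃₁ , x₂) , refl) = proj₂ (extension _) ((x ∷ _) , x̃₁ , refl) , x₂

  parallel-extend : ∀ {Ã g f} → ParallelInContraction Ã g f →
    ParallelInContraction (Ã ⊕⟨ extend σ ⟩ B) (ι₁ σ g) (ι₁ σ f)
  parallel-extend {g = g} {f} parallel (x ∷ X) (x̃₁ , _) Xg≡0 =
    trans (parallel _ x̃₁ (trans (lookup-restrict (ι₁ σ) X g) Xg≡0)) (lookup-restrict (ι₁ σ) X f)

  euclideanExtension-⊕⟨⟩ : IsOM B → ∀ {g f Y} → EuclideanExtension A g f Y →
    EuclideanExtension (A ⊕⟨ σ ⟩ B) (ι₁ σ g) (ι₁ σ f) (glue σ Y 0v)
  euclideanExtension-⊕⟨⟩ isOMᴮ {Y = Y} (Ã , isOMÃ , extension , parallel , cocircuit) =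
    Ã ⊕⟨ extend σ ⟩ B , isOM-⊕⟨⟩ (extend σ) isOMÃ isOMᴮ , isExtension-extend extension ,
    parallel-extend parallel ,
    subst (IsCocircuit _) (glue-extend σ zer Y 0v) (cocircuit-glue⁺ (extend σ) {Ã} {B} isOMᴮ cocircuit)

  euclidean-ι₁-ι₁ : IsOM B → IsEuclidean A → ∀ {g f} → ¬ IsLoop A g → ¬ IsColoop A f →
    IsEuclideanProgram (A ⊕⟨ σ ⟩ B) (ι₁ σ g) (ι₁ σ f)
  euclidean-ι₁-ι₁ isOMᴮ euclid {g} {f} ¬loop ¬coloop Y cocircuit Yg≡+ =
    subst (EuclideanExtension (A ⊕⟨ σ ⟩ B) (ι₁ σ g) (ι₁ σ f)) (sym Y≡glue)
      (euclideanExtension-⊕⟨⟩ isOMᴮ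
        (euclid g f ¬loop ¬coloop (restrict (ι₁ σ) Y) cocircuit₁ (trans (lookup-restrict (ι₁ σ) Y g) Yg≡+)))
    where
      Y≡glue = cocircuit-support₁ σ {A} {B} isOMᴮ {Y} {g} cocircuit (plus≢zer ∘ trans (sym Yg≡+))
      cocircuit₁ = cocircuit-glue⁻ σ {A} {B} isOMᴮ (subst (IsCocircuit (A ⊕⟨ σ ⟩ B)) Y≡glue cocircuit)

  euclidean-ι₁-ι₂ : IsOM A → IsOM B → ∀ g f → IsEuclideanProgram (A ⊕⟨ σ ⟩ B) (ι₁ σ g) (ι₂ σ f)
  euclidean-ι₁-ι₂ isOMᴬ isOMᴮ g f Y cocircuit Yg≡+ =
    copy-extension (ι₂ σ f) (isOM-⊕⟨⟩ σ isOMᴬ isOMᴮ) cocircuit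
      (trans (cong (λ V → lookup V (ι₂ σ f)) Y≡glue)
             (trans (lookup-glue₂ σ (restrict (ι₁ σ) Y) 0v f) (lookup-0v f)))
    where Y≡glue = cocircuit-support₁ σ {A} {B} isOMᴮ {Y} {g} cocircuit (plus≢zer ∘ trans (sym Yg≡+))

  euclidean-ι₁ : IsOM A → IsOM B → IsEuclidean A → ∀ {g} f → ¬ IsLoop A g →
    ¬ IsColoop (A ⊕⟨ σ ⟩ B) f → IsEuclideanProgram (A ⊕⟨ σ ⟩ B) (ι₁ σ g) f
  euclidean-ι₁ isOMᴬ isOMᴮ euclid {g} f ¬loop =
    by-blocks σ (λ f → ¬ IsColoop (A ⊕⟨ σ ⟩ B) f → IsEuclideanProgram (A ⊕⟨ σ ⟩ B) (ι₁ σ g) f)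
    (λ f₁ ¬coloop → euclidean-ι₁-ι₁ isOMᴮ euclid ¬loop (¬coloop ∘ isColoop-ι₁ σ {A} {B} isOMᴮ))
    (λ f₂ _ → euclidean-ι₁-ι₂ isOMᴬ isOMᴮ g f₂)
    f

isEuclidean-⊕⟨⟩ : ∀ {a b} (σ : Fin k ↔ (Fin a ⊎ Fin b)) {A B} → IsOM A → IsOM B →
  IsEuclidean A → IsEuclidean B → IsEuclidean (A ⊕⟨ σ ⟩ B)
isEuclidean-⊕⟨⟩ σ {A} {B} isOMᴬ isOMᴮ euclidᴬ euclidᴮ g f ¬loop ¬coloop =
  by-blocks σ (λ g → ¬ IsLoop (A ⊕⟨ σ ⟩ B) g → IsEuclideanProgram (A ⊕⟨ σ ⟩ B) g f)
    (λ g₁ ¬loop → euclidean-ι₁ σ isOMᴬ isOMᴮ euclidᴬ f (¬loop ∘ isLoop-ι₁ σ {A} {B}) ¬coloop)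
    (λ g₂ ¬loop → isEuclideanProgram-resp swap⁺ swap⁻
       (euclidean-ι₁ (swap σ) {B} {A} isOMᴮ isOMᴬ euclidᴮ f
          (¬loop ∘ isLoop-resp swap⁺ swap⁻ ∘ isLoop-ι₁ (swap σ) {B} {A})
          (¬coloop ∘ isColoop-resp swap⁺ swap⁻)))
    g ¬loop
  where
    swap⁺ : ∀ X → (A ⊕⟨ σ ⟩ B) X → (B ⊕⟨ swap σ ⟩ A) X
    swap⁺ _ = Product.swap

    swap⁻ : ∀ X → (B ⊕⟨ swap σ ⟩ A) X → (A ⊕⟨ σ ⟩ B) X
    swap⁻ _ = Product.swap

restrict-++₁ : ∀ {m n} (U : SignVec m) (V : SignVec n) → restrict (ι₁ +↔⊎) (U ++ V) ≡ U
restrict-++₁ U V = lookup-ext λ i → trans (lookup-restrict (ι₁ +↔⊎) (U ++ V) i) (lookup-++ˡ U V i)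

restrict-++₂ : ∀ {m n} (U : SignVec m) (V : SignVec n) → restrict (ι₂ +↔⊎) (U ++ V) ≡ V
restrict-++₂ U V = lookup-ext λ j → trans (lookup-restrict (ι₂ +↔⊎) (U ++ V) j) (lookup-++ʳ U V j)

module _ {m n} {L₁ : Covectors m} {L₂ : Covectors n} where

  ⊕⇒⊕⟨+↔⊎⟩ : ∀ X → (L₁ ⊕ L₂) X → (L₁ ⊕⟨ +↔⊎ ⟩ L₂) X
  ⊕⇒⊕⟨+↔⊎⟩ _ (U , V , u , v , refl) =
    subst L₁ (sym (restrict-++₁ U V)) u , subst L₂ (sym (restrict-++₂ U V)) v

  ⊕⟨+↔⊎⟩⇒⊕ : ∀ X → (L₁ ⊕⟨ +↔⊎ ⟩ L₂) X → (L₁ ⊕ L₂) X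
  ⊕⟨+↔⊎⟩⇒⊕ X (x₁ , x₂) =
    X₁ , X₂ , x₁ , x₂ , restrict-injective +↔⊎ (sym (restrict-++₁ X₁ X₂)) (sym (restrict-++₂ X₁ X₂))
    where
      X₁ = restrict (ι₁ +↔⊎) X
      X₂ = restrict (ι₂ +↔⊎) X

mainTheorem13 : ∀ {m n} (L₁ : Covectors m) (L₂ : Covectors n) →
    IsOM L₁ → IsOM L₂ → IsEuclidean L₁ → IsEuclidean L₂ → IsEuclidean (L₁ ⊕ L₂)
mainTheorem13 L₁ L₂ isOM₁ isOM₂ euclid₁ euclid₂ =
  isEuclidean-resp ⊕⇒⊕⟨+↔⊎⟩ ⊕⟨+↔⊎⟩⇒⊕ (isEuclidean-⊕⟨⟩ +↔⊎ isOM₁ isOM₂ euclid₁ euclid₂)
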